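{- Let $H$ be a finite hypergraph and let $f$ be a perfect coloring of $H$. Then $f$ is a perfect coloring of the multigraph $\mathcal{M}_{12}(\mathcal{D}(H))$, i.e. of the multigraph on $V(H)$ in which two distinct vertices $x,y$ are joined by as many edges as there are hyperedges containing both $x$ and $y$, and each vertex $x$ carries as many loops as there are hyperedges containing $x$.
   Context: A coloring $f$ of the vertices of a hypergraph $H$ is perfect if for any two vertices $x,y$ with $f(x)=f(y)$ and any multiset $\mu$ of colors, the number of hyperedges containing $x$ whose multiset of vertex colors is $\mu$ equals the corresponding number for $y$ (equivalently, coloring each hyperedge by its multiset of vertex colors gives a perfect coloring of the bipartite vertex–hyperedge incidence graph $\mathcal{D}(H)$). For a multigraph with adjacency matrix $M$ (loops on the diagonal), a coloring $f$ is perfect if there is a matrix $S=(s_{ij})$ such that for all colors $i,j$ and every vertex $x$ of color $i$, $\sum_{y:\,f(y)=j}M_{xy}=s_{ij}$. -}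

module Defs where

open import Data.Nat using (ℕ; zero; suc; _+_; _*_)
open import Data.Bool using (Bool; true; false; _∧_; if_then_else_)
open import Data.Fin using (Fin; zero; suc; _≟_)
open import Data.Fin.Properties using (all?)
open import Data.Vec using (Vec; lookup)
open import Data.Product using (Σ; ∃)
open import Relation.Nullary.Decidable using (⌊_⌋)
open import Relation.Binary.PropositionalEquality using (_≡_)
import Data.Nat as ℕ

∑ : ∀ {m : ℕ} → (Fin m → ℕ) → ℕ
∑ {zero}  g = 0
∑ {suc m} g = g zero + ∑ {m} (λ i → g (suc i))

χ : Bool → ℕ
χ true  = 1
χ false = 0

-- A finite hypergraph: vertex set Fin n, hyperedges indexed by Fin m,
-- each hyperedge being a subset of the vertices (characteristic vector).
record Hypergraph : Set where
  field
    n    : ℕ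
    m    : ℕ
    edge : Fin m → Vec Bool n

open Hypergraph public

_∋ᴴ_ : (H : Hypergraph) → Fin (m H) → Fin (n H) → Bool
(H ∋ᴴ e) x = lookup (edge H e) x

Colouring : Hypergraph → ℕ → Set
Colouring H k = Fin (n H) → Fin k

Multiset : ℕ → Set
Multiset k = Fin k → ℕ

colourMultiset : (H : Hypergraph) {k : ℕ} → Colouring H k → Fin (m H) → Multiset k
colourMultiset H f e c = ∑ (λ y → χ ((H ∋ᴴ e) y ∧ ⌊ f y ≟ c ⌋))

edgeCount : (H : Hypergraph) {k : ℕ} → Colouring H k → Fin (n H) → Multiset k → ℕ
edgeCount H {k} f x μ =
  ∑ (λ e → χ ((H ∋ᴴ e) x ∧ ⌊ all? (λ c → colourMultiset H f e c ℕ.≟ μ c) ⌋))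

IsPerfectHyp : (H : Hypergraph) {k : ℕ} → Colouring H k → Set
IsPerfectHyp H {k} f =
  ∀ (x y : Fin (n H)) → f x ≡ f y → ∀ (μ : Multiset k) → edgeCount H f x μ ≡ edgeCount H f y μ

IsPerfectMulti : {N : ℕ} → (Fin N → Fin N → ℕ) → {k : ℕ} → (Fin N → Fin k) → Set
IsPerfectMulti {N} M {k} f =
  Σ (Fin k → Fin k → ℕ) (λ S →
    ∀ (i j : Fin k) (x : Fin N) → f x ≡ i → ∑ (λ y → M x y * χ ⌊ f y ≟ j ⌋) ≡ S i j)

M12D : (H : Hypergraph) → Fin (n H) → Fin (n H) → ℕ
M12D H x y =
  if ⌊ x ≟ y ⌋
  then ∑ (λ e → χ ((H ∋ᴴ e) x))
  else ∑ (λ e → χ ((H ∋ᴴ e) x ∧ (H ∋ᴴ e) y))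

-- Double counting: the number of edges of M₁₂(D(H)) from x into colour class j is
-- ∑ₑ [x ∈ e]·μₑ(j), where μₑ is the colour multiset of the hyperedge e (the term y = x
-- accounts for the loops).  Grouping the hyperedges by μₑ, this sum depends only on the
-- numbers of hyperedges through x with each given multiset, which a perfect colouring of
-- H makes equal for any two vertices of the same colour.

module Submission where

open import Defs
open import Data.Nat using (ℕ; zero; suc; _+_; _*_)
open import Data.Nat.Properties
  using (+-*-semiring; ≡-decSetoid; *-zeroʳ; *-identityʳ; +-identityʳ; *-assoc)
open import Data.Bool using (true; false; _∧_; if_then_else_)
open import Data.Bool.Properties using (∧-idem)
open import Data.Fin using (Fin; zero; suc)
import Data.Fin as Fin
open import Data.Fin.Properties using (any?)
open import Data.Product using (Σ; _,_; proj₁; proj₂)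
open import Data.Vec.Functional.Relation.Binary.Pointwise.Properties using (decSetoid)
open import Function using (_∘_)
open import Relation.Binary.Bundles using (DecSetoid)
open import Relation.Binary.Core using (_Preserves_⟶_)
open import Relation.Binary.PropositionalEquality
  using (_≡_; _≗_; refl; sym; trans; cong; cong₂; module ≡-Reasoning)
open import Relation.Nullary using (yes; no; contradiction)
open import Relation.Nullary.Decidable using (⌊_⌋)
open import Algebra.Properties.Semiring.Sum +-*-semiring
  using (sum; sum-cong-≗; sum-replicate-zero; *-distribˡ-sum; *-distribʳ-sum)
  renaming (∑-comm to sum-comm; ∑-distrib-+ to sum-distrib-+)

open ≡-Reasoning

∑≗sum : ∀ {m} (g : Fin m → ℕ) → ∑ g ≡ sum g
∑≗sum {zero}  g = refl
∑≗sum {suc m} g = cong (g zero +_) (∑≗sum (g ∘ suc))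

∑-cong : ∀ {m} {g h : Fin m → ℕ} → g ≗ h → ∑ g ≡ ∑ h
∑-cong {g = g} {h} g≗h = trans (∑≗sum g) (trans (sum-cong-≗ g≗h) (sym (∑≗sum h)))

∑-zero : ∀ m → ∑ {m} (λ _ → 0) ≡ 0
∑-zero m = trans (∑≗sum {m} (λ _ → 0)) (sum-replicate-zero m)

∑-distrib-+ : ∀ {m} (g h : Fin m → ℕ) → ∑ (λ i → g i + h i) ≡ ∑ g + ∑ h
∑-distrib-+ g h = begin
  ∑ (λ i → g i + h i)   ≡⟨ ∑≗sum (λ i → g i + h i) ⟩
  sum (λ i → g i + h i) ≡⟨ sum-distrib-+ g h ⟩
  sum g + sum h         ≡⟨ cong₂ _+_ (∑≗sum g) (∑≗sum h) ⟨
  ∑ g + ∑ h             ∎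

*-distribˡ-∑ : ∀ {m} c (g : Fin m → ℕ) → c * ∑ g ≡ ∑ (λ i → c * g i)
*-distribˡ-∑ c g = begin
  c * ∑ g              ≡⟨ cong (c *_) (∑≗sum g) ⟩
  c * sum g            ≡⟨ *-distribˡ-sum c g ⟩
  sum (λ i → c * g i)  ≡⟨ ∑≗sum (λ i → c * g i) ⟨
  ∑ (λ i → c * g i)    ∎

*-distribʳ-∑ : ∀ {m} c (g : Fin m → ℕ) → ∑ g * c ≡ ∑ (λ i → g i * c)
*-distribʳ-∑ c g = begin
  ∑ g * c              ≡⟨ cong (_* c) (∑≗sum g) ⟩
  sum g * c            ≡⟨ *-distribʳ-sum c g ⟩
  sum (λ i → g i * c)  ≡⟨ ∑≗sum (λ i → g i * c) ⟨
  ∑ (λ i → g i * c)    ∎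

∑-comm : ∀ {m n} (g : Fin m → Fin n → ℕ) →
  ∑ (λ i → ∑ (λ j → g i j)) ≡ ∑ (λ j → ∑ (λ i → g i j))
∑-comm g = begin
  ∑ (λ i → ∑ (g i))                    ≡⟨ ∑≗sum (λ i → ∑ (g i)) ⟩
  sum (λ i → ∑ (g i))                  ≡⟨ sum-cong-≗ (∑≗sum ∘ g) ⟩
  sum (λ i → sum (g i))                ≡⟨ sum-comm g ⟩
  sum (λ j → sum (λ i → g i j))        ≡⟨ sum-cong-≗ (λ j → ∑≗sum (λ i → g i j)) ⟨
  sum (λ j → ∑ (λ i → g i j))          ≡⟨ ∑≗sum (λ j → ∑ (λ i → g i j)) ⟨
  ∑ (λ j → ∑ (λ i → g i j))            ∎

∑-head-zero : ∀ {m} (g : Fin (suc m) → ℕ) → g zero ≡ 0 → ∑ g ≡ ∑ (g ∘ suc)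
∑-head-zero g g₀≡0 = cong (_+ ∑ (g ∘ suc)) g₀≡0

χ-∧ : ∀ a b → χ (a ∧ b) ≡ χ a * χ b
χ-∧ true  true  = refl
χ-∧ true  false = refl
χ-∧ false _     = refl

χ-idem : ∀ b → χ b ≡ χ b * χ b
χ-idem b = trans (cong χ (sym (∧-idem b))) (χ-∧ b b)

module WeightedLabels {c ℓ} (L : DecSetoid c ℓ) where

  open DecSetoid L
    using (_≈_; _≟_)
    renaming (Carrier to Label; refl to ≈-refl; sym to ≈-sym; trans to ≈-trans)

  labelWeight : ∀ {m} → (Fin m → ℕ) → (Fin m → Label) → Label → ℕ
  labelWeight w lab l = ∑ (λ e → w e * χ ⌊ lab e ≟ l ⌋)

  weightedSum : ∀ {m} → (Fin m → ℕ) → (Fin m → Label) → (Label → ℕ) → ℕ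
  weightedSum w lab g = ∑ (λ e → w e * g (lab e))

  dropLabel : ∀ {m} → Label → (Fin m → Label) → (Fin m → ℕ) → Fin m → ℕ
  dropLabel l lab w e = if ⌊ lab e ≟ l ⌋ then 0 else w e

  dropLabel-≈ : ∀ {m} {l} (lab : Fin m → Label) (w : Fin m → ℕ) {e} →
    lab e ≈ l → dropLabel l lab w e ≡ 0
  dropLabel-≈ {l = l} lab w {e} lab≈l with lab e ≟ l
  ... | yes _    = refl
  ... | no lab≉l = contradiction lab≈l lab≉l

  labelWeight-dropLabel : ∀ {m} l (lab : Fin m → Label) (w : Fin m → ℕ) l′ →
    labelWeight (dropLabel l lab w) lab l′ ≡ (if ⌊ l ≟ l′ ⌋ then 0 else labelWeight w lab l′)
  labelWeight-dropLabel {m} l lab w l′ with l ≟ l′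
  ... | yes l≈l′ = trans (∑-cong vanishes) (∑-zero m)
    where
    vanishes : ∀ e → dropLabel l lab w e * χ ⌊ lab e ≟ l′ ⌋ ≡ 0
    vanishes e with lab e ≟ l | lab e ≟ l′
    ... | yes _   | _        = refl
    ... | no _    | no _     = *-zeroʳ (w e)
    ... | no e≉l  | yes e≈l′ = contradiction (≈-trans e≈l′ (≈-sym l≈l′)) e≉l
  ... | no l≉l′ = ∑-cong unchanged
    where
    unchanged : ∀ e → dropLabel l lab w e * χ ⌊ lab e ≟ l′ ⌋ ≡ w e * χ ⌊ lab e ≟ l′ ⌋
    unchanged e with lab e ≟ l | lab e ≟ l′
    ... | no _    | _        = refl
    ... | yes _   | no _     = sym (*-zeroʳ (w e))
    ... | yes e≈l | yes e≈l′ = contradiction (≈-trans (≈-sym e≈l) e≈l′) l≉l′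

  module _ {g : Label → ℕ} (g-cong : g Preserves _≈_ ⟶ _≡_) where

    weightedSum-split : ∀ {m} l (w : Fin m → ℕ) (lab : Fin m → Label) →
      weightedSum w lab g ≡ labelWeight w lab l * g l + weightedSum (dropLabel l lab w) lab g
    weightedSum-split l w lab = begin
      weightedSum w lab g
        ≡⟨ ∑-cong split ⟩
      ∑ (λ e → selected e * g l + remaining e)
        ≡⟨ ∑-distrib-+ (λ e → selected e * g l) remaining ⟩
      ∑ (λ e → selected e * g l) + ∑ remaining
        ≡⟨ cong (_+ ∑ remaining) (*-distribʳ-∑ (g l) selected) ⟨
      labelWeight w lab l * g l + weightedSum (dropLabel l lab w) lab g ∎
      where
      selected remaining : Fin _ → ℕ
      selected e  = w e * χ ⌊ lab e ≟ l ⌋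
      remaining e = dropLabel l lab w e * g (lab e)

      split : ∀ e → w e * g (lab e) ≡ selected e * g l + remaining e
      split e with lab e ≟ l
      ... | yes e≈l = begin
        w e * g (lab e)      ≡⟨ cong (w e *_) (g-cong e≈l) ⟩
        w e * g l            ≡⟨ cong (_* g l) (*-identityʳ (w e)) ⟨
        w e * 1 * g l        ≡⟨ +-identityʳ _ ⟨
        w e * 1 * g l + 0    ∎
      ... | no _ = sym (cong (λ z → z * g l + w e * g (lab e)) (*-zeroʳ (w e)))

    weightedSum-tail : ∀ {m} (w : Fin (suc m) → ℕ) (lab : Fin (suc m) → Label) →
      w zero ≡ 0 → weightedSum w lab g ≡ weightedSum (w ∘ suc) (lab ∘ suc) g
    weightedSum-tail w lab w₀≡0 =
      ∑-head-zero (λ e → w e * g (lab e)) (cong (_* g (lab zero)) w₀≡0)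

  labelWeight-tail : ∀ {m} (w : Fin (suc m) → ℕ) (lab : Fin (suc m) → Label) →
    w zero ≡ 0 → labelWeight w lab ≗ labelWeight (w ∘ suc) (lab ∘ suc)
  labelWeight-tail w lab w₀≡0 l =
    ∑-head-zero (λ e → w e * χ ⌊ lab e ≟ l ⌋) (cong (_* χ ⌊ lab zero ≟ l ⌋) w₀≡0)

  -- All indices labelled like index zero are removed at once,
  -- so the remaining label weights still agree.
  labelWeight≗⇒weightedSum≡ : ∀ {g} → g Preserves _≈_ ⟶ _≡_ →
    ∀ {m} (w v : Fin m → ℕ) (lab : Fin m → Label) →
    labelWeight w lab ≗ labelWeight v lab → weightedSum w lab g ≡ weightedSum v lab g
  labelWeight≗⇒weightedSum≡ g-cong {zero}  w v lab same = refl
  labelWeight≗⇒weightedSum≡ {g} g-cong {suc m} w v lab same = begin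
    weightedSum w lab g
      ≡⟨ weightedSum-split g-cong l₀ w lab ⟩
    labelWeight w lab l₀ * g l₀ + weightedSum (rest w) lab g
      ≡⟨ cong₂ _+_ (cong (_* g l₀) (same l₀)) rests-agree ⟩
    labelWeight v lab l₀ * g l₀ + weightedSum (rest v) lab g
      ≡⟨ weightedSum-split g-cong l₀ v lab ⟨
    weightedSum v lab g ∎
    where
    l₀ : Label
    l₀ = lab zero

    rest : (Fin (suc m) → ℕ) → Fin (suc m) → ℕ
    rest = dropLabel l₀ lab

    rest₀≡0 : ∀ u → rest u zero ≡ 0
    rest₀≡0 u = dropLabel-≈ lab u ≈-refl

    rest-tail : (Fin (suc m) → ℕ) → Fin m → ℕ
    rest-tail u = rest u ∘ suc

    tails-same : labelWeight (rest-tail w) (lab ∘ suc) ≗ labelWeight (rest-tail v) (lab ∘ suc)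
    tails-same l = begin
      labelWeight (rest-tail w) (lab ∘ suc) l
        ≡⟨ labelWeight-tail (rest w) lab (rest₀≡0 w) l ⟨
      labelWeight (rest w) lab l
        ≡⟨ labelWeight-dropLabel l₀ lab w l ⟩
      (if ⌊ l₀ ≟ l ⌋ then 0 else labelWeight w lab l)
        ≡⟨ cong (if ⌊ l₀ ≟ l ⌋ then 0 else_) (same l) ⟩
      (if ⌊ l₀ ≟ l ⌋ then 0 else labelWeight v lab l)
        ≡⟨ labelWeight-dropLabel l₀ lab v l ⟨
      labelWeight (rest v) lab l
        ≡⟨ labelWeight-tail (rest v) lab (rest₀≡0 v) l ⟩
      labelWeight (rest-tail v) (lab ∘ suc) l ∎

    rests-agree : weightedSum (rest w) lab g ≡ weightedSum (rest v) lab g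
    rests-agree = begin
      weightedSum (rest w) lab g
        ≡⟨ weightedSum-tail g-cong (rest w) lab (rest₀≡0 w) ⟩
      weightedSum (rest-tail w) (lab ∘ suc) g
        ≡⟨ labelWeight≗⇒weightedSum≡ g-cong (rest-tail w) (rest-tail v) (lab ∘ suc) tails-same ⟩
      weightedSum (rest-tail v) (lab ∘ suc) g
        ≡⟨ weightedSum-tail g-cong (rest v) lab (rest₀≡0 v) ⟨
      weightedSum (rest v) lab g ∎

constantOnFibres⇒factors : ∀ {a} {A : Set a} {N k} (f : Fin N → Fin k) (R : Fin N → A) →
  A → (∀ {x y} → f x ≡ f y → R x ≡ R y) →
  Σ (Fin k → A) λ S → ∀ i x → f x ≡ i → R x ≡ S i
constantOnFibres⇒factors {A = A} {k = k} f R default R-cong = S , R≡S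
  where
  S : Fin k → A
  S i with any? (λ x → f x Fin.≟ i)
  ... | yes (x , _) = R x
  ... | no _        = default

  R≡S : ∀ i x → f x ≡ i → R x ≡ S i
  R≡S i x fx≡i with any? (λ x → f x Fin.≟ i)
  ... | yes (x′ , fx′≡i) = R-cong (trans fx≡i (sym fx′≡i))
  ... | no empty         = contradiction (x , fx≡i) empty

module _ (H : Hypergraph) where

  incidence : Fin (m H) → Fin (n H) → ℕ
  incidence e x = χ ((H ∋ᴴ e) x)

  M12D≡∑incidence : ∀ x y → M12D H x y ≡ ∑ (λ e → incidence e x * incidence e y)
  M12D≡∑incidence x y with x Fin.≟ y
  ... | yes refl = ∑-cong (λ e → χ-idem ((H ∋ᴴ e) x))
  ... | no _     = ∑-cong (λ e → χ-∧ ((H ∋ᴴ e) x) ((H ∋ᴴ e) y))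

  module _ {k : ℕ} (f : Colouring H k) where

    open WeightedLabels (decSetoid ≡-decSetoid k)

    colourDegree : Fin (n H) → Fin k → ℕ
    colourDegree x j = ∑ (λ y → M12D H x y * χ ⌊ f y Fin.≟ j ⌋)

    colourDegree≡∑edges : ∀ x j →
      colourDegree x j ≡ weightedSum (λ e → incidence e x) (colourMultiset H f) (λ μ → μ j)
    colourDegree≡∑edges x j = begin
      ∑ (λ y → M12D H x y * [ y ])
        ≡⟨ ∑-cong (λ y → cong (_* [ y ]) (M12D≡∑incidence x y)) ⟩
      ∑ (λ y → ∑ (λ e → incidence e x * incidence e y) * [ y ])
        ≡⟨ ∑-cong (λ y → *-distribʳ-∑ [ y ] (λ e → incidence e x * incidence e y)) ⟩
      ∑ (λ y → ∑ (λ e → incidence e x * incidence e y * [ y ]))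
        ≡⟨ ∑-comm (λ y e → incidence e x * incidence e y * [ y ]) ⟩
      ∑ (λ e → ∑ (λ y → incidence e x * incidence e y * [ y ]))
        ≡⟨ ∑-cong (λ e → ∑-cong (λ y → *-assoc (incidence e x) (incidence e y) [ y ])) ⟩
      ∑ (λ e → ∑ (λ y → incidence e x * (incidence e y * [ y ])))
        ≡⟨ ∑-cong (λ e → *-distribˡ-∑ (incidence e x) (λ y → incidence e y * [ y ])) ⟨
      ∑ (λ e → incidence e x * ∑ (λ y → incidence e y * [ y ]))
        ≡⟨ ∑-cong (λ e → cong (incidence e x *_) (∑-cong (λ y → χ-∧ ((H ∋ᴴ e) y) _))) ⟨
      ∑ (λ e → incidence e x * colourMultiset H f e j) ∎
      where
      [_] : Fin (n H) → ℕ
      [ y ] = χ ⌊ f y Fin.≟ j ⌋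

    -- The decision procedure of the pointwise DecSetoid is exactly the all?-test inside edgeCount.
    edgeCount≡labelWeight : ∀ x →
      edgeCount H f x ≗ labelWeight (λ e → incidence e x) (colourMultiset H f)
    edgeCount≡labelWeight x μ = ∑-cong (λ e → χ-∧ ((H ∋ᴴ e) x) _)

    perfect⇒colourDegree-cong : IsPerfectHyp H f →
      ∀ {x y} → f x ≡ f y → ∀ j → colourDegree x j ≡ colourDegree y j
    perfect⇒colourDegree-cong perfect {x} {y} fx≡fy j = begin
      colourDegree x j
        ≡⟨ colourDegree≡∑edges x j ⟩
      weightedSum (λ e → incidence e x) (colourMultiset H f) (λ μ → μ j)
        ≡⟨ labelWeight≗⇒weightedSum≡ (λ μ≋ν → μ≋ν j)
             (λ e → incidence e x) (λ e → incidence e y) (colourMultiset H f) sameCounts ⟩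
      weightedSum (λ e → incidence e y) (colourMultiset H f) (λ μ → μ j)
        ≡⟨ colourDegree≡∑edges y j ⟨
      colourDegree y j ∎
      where
      sameCounts : labelWeight (λ e → incidence e x) (colourMultiset H f)
                 ≗ labelWeight (λ e → incidence e y) (colourMultiset H f)
      sameCounts μ = begin
        labelWeight (λ e → incidence e x) (colourMultiset H f) μ ≡⟨ edgeCount≡labelWeight x μ ⟨
        edgeCount H f x μ                                       ≡⟨ perfect x y fx≡fy μ ⟩
        edgeCount H f y μ                                       ≡⟨ edgeCount≡labelWeight y μ ⟩
        labelWeight (λ e → incidence e y) (colourMultiset H f) μ ∎

corollary3 : (H : Hypergraph) (k : ℕ) (f : Colouring H k) →
    IsPerfectHyp H f → IsPerfectMulti (M12D H) f
corollary3 H k f perfect = (λ i j → proj₁ (factor j) i) , (λ i j → proj₂ (factor j) i)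
  where
  factor : ∀ j → Σ (Fin k → ℕ) λ S → ∀ i x → f x ≡ i → colourDegree H f x j ≡ S i
  factor j = constantOnFibres⇒factors f (λ x → colourDegree H f x j) 0
               (λ fx≡fy → perfect⇒colourDegree-cong H f perfect fx≡fy j)
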